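{- Let $t\ge1$, let $G$ be a group of order $4t+2$ and let $\psi\in Z^2(G,\langle-1\rangle)$. Let $X_1=\{g\in G\setminus\{1\}:\sum_{h\in G}\psi(g,h)=\pm2\}$ and $X_2=\{g\in G\setminus\{1\}:\sum_{h\in G}\psi(g,h)=0\}$. Then $\psi$ is quasi-orthogonal if and only if $|X_1|=2t$ and $|X_2|=2t+1$.
   Context: A (normalized) cocycle is a map $\psi:G\times G\to\{\pm1\}$ with $\psi(g,h)\psi(gh,k)=\psi(g,hk)\psi(h,k)$ for all $g,h,k\in G$ and $\psi(1,1)=1$; $Z^2(G,\langle-1\rangle)$ is the set of these. For an ordering $g_1=1,g_2,\dots,g_{4t+2}$ of $G$, $M_\psi=[\psi(g_i,g_j)]_{i,j}$ (its first row is all $1$s). For an $n\times n$ $(\pm1)$-matrix $M=[m_{i,j}]$ with first row all $1$s, $RE(M)=\sum_{i=2}^n|\sum_{j=1}^n m_{i,j}|$. The cocycle $\psi$ is called quasi-orthogonal if $RE(M_\psi)=4t$ (this does not depend on the ordering with $g_1=1$). -}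

module Defs where

import Data.Nat
open import Data.Nat using (ℕ)
open import Data.Integer using (ℤ; +_; -_; _+_; ∣_∣)
open import Data.Sign using (Sign) renaming (_*_ to _*ˢ_)
open import Data.Fin using (Fin)
open import Data.Fin.Properties using (_≟_)
open import Data.List using (List; foldr; map; filter; length; allFin)
open import Data.Product using (_×_)
open import Data.Sum using (_⊎_)
open import Relation.Nullary using (¬_)
open import Relation.Nullary.Decidable using (_×-dec_; _⊎-dec_; ¬?)
open import Relation.Binary.PropositionalEquality using (_≡_)
import Data.Integer.Properties as ℤP

sgn : Sign → ℤ
sgn Sign.+ = + 1
sgn Sign.- = - (+ 1)

sumℤ : List ℤ → ℤ
sumℤ = foldr _+_ (+ 0)

sumℕ : List ℕ → ℕ
sumℕ = foldr Data.Nat._+_ 0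

module _ {n : ℕ} where

  record IsCocycle (_·_ : Fin n → Fin n → Fin n) (e : Fin n)
                   (ψ : Fin n → Fin n → Sign) : Set where
    field
      cocycle    : ∀ g h k → (ψ g h *ˢ ψ (g · h) k) ≡ (ψ g (h · k) *ˢ ψ h k)
      normalized : ψ e e ≡ Sign.+

  rowSum : (ψ : Fin n → Fin n → Sign) → Fin n → ℤ
  rowSum ψ g = sumℤ (map (λ h → sgn (ψ g h)) (allFin n))

  RE : (e : Fin n) (ψ : Fin n → Fin n → Sign) → ℕ
  RE e ψ = sumℕ (map (λ g → ∣ rowSum ψ g ∣) (filter (λ g → ¬? (g ≟ e)) (allFin n)))

  cardX₁ : (e : Fin n) (ψ : Fin n → Fin n → Sign) → ℕ
  cardX₁ e ψ = length (filter
    (λ g → ¬? (g ≟ e) ×-dec ((rowSum ψ g ℤP.≟ + 2) ⊎-dec (rowSum ψ g ℤP.≟ - (+ 2))))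
    (allFin n))

  cardX₂ : (e : Fin n) (ψ : Fin n → Fin n → Sign) → ℕ
  cardX₂ e ψ = length (filter
    (λ g → ¬? (g ≟ e) ×-dec (rowSum ψ g ℤP.≟ + 0))
    (allFin n))

module Submission where

-- Proof strategy.  Write G = Fin n with n = 4t+2, r_g = Σ_h ψ(g,h) for the
-- row sums and Φ(g) = Π_h ψ(g,h) for the row products.
--
--  * A ±1-sum of length m is congruent to m modulo 4, shifted by 2 when the
--    product of the terms is -1.  Hence a row with Φ(g) = +1 has |r_g| ≡ 2
--    (mod 4), so |r_g| ≥ 2; rows with Φ(g) = -1 have no constraint.
--  * Multiplying the cocycle identity over k and reindexing k ↦ hk shows
--    that Φ is a homomorphism G → {±1} (n is even, so ψ(g,h)^n = 1).  If Φ
--    is nontrivial, translation by an element outside its kernel swaps the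
--    kernel and its complement, so Φ takes the value -1 exactly 2t+1 times.
--  * (⇐) X₁ and X₂ are disjoint and together have 4t+1 = |G ∖ {1}|
--    elements, so every nonidentity row sum is ±2 or 0, and RE = 2|X₁| = 4t.
--  * (⇒) RE ≥ Σ_{g≠1} 2·[Φ(g) = +1].  A trivial Φ would give RE ≥ 2(4t+1);
--    otherwise the bound is 2·2t = 4t, so RE = 4t forces |r_g| = 2 when
--    Φ(g) = +1 and r_g = 0 when Φ(g) = -1.  Thus X₁ and X₂ are exactly the
--    nonidentity elements of the kernel of Φ and of its complement.

open import Defs
open import Data.Nat using (ℕ; _+_; _*_; _≤_)
open import Data.Fin using (Fin)
open import Data.Sign using (Sign)
open import Data.Product using (_×_)
open import Function.Bundles using (_⇔_)
open import Algebra.Structures using (IsGroup)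
open import Relation.Binary.PropositionalEquality using (_≡_)

open import Data.Nat as ℕ using (zero; suc; z≤n; _≡ᵇ_)
open import Data.Integer as ℤ using (ℤ; -[1+_]; -_; ∣_∣) renaming (+_ to +ℤ_)
open import Data.Sign as Sign using ()
open import Data.Bool using (Bool; true; false; not; _∧_; _∨_; if_then_else_)
open import Data.Bool.Properties using (∨-identityʳ)
open import Data.Fin using (zero; suc)
open import Data.Fin.Properties using (_≟_; any?)
open import Data.Fin.Permutation using (Permutation′; permutation)
open import Data.List using ([]; _∷_; map; filter; length; foldr; tabulate; allFin)
open import Data.List.Properties using (map-tabulate)
import Data.Vec.Functional as Vector
open import Data.Product using (∃; _,_; proj₁; proj₂)
open import Data.Empty using (⊥-elim)
open import Function using (_∘_; id)
open import Function.Bundles using (mk⇔)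
open import Relation.Nullary using (yes; no; does; ¬_; ¬?)
open import Relation.Unary using (Pred; Decidable)
open import Relation.Binary.PropositionalEquality
  using (refl; sym; trans; cong; cong₂; subst; subst₂; module ≡-Reasoning)
import Data.Nat.Properties as ℕP
import Data.Integer.Properties as ℤP
import Data.Sign.Properties as SignP
open import Data.Integer.Tactic.RingSolver using (solve-∀)
import Data.Nat.Tactic.RingSolver as ℕSolver
import Algebra.Properties.CommutativeMonoid.Sum as FiniteSum

open FiniteSum ℕP.+-0-commutativeMonoid
  using () renaming (sum to ∑; sum-cong-≗ to ∑-cong; ∑-distrib-+ to ∑-+; sum-permute to ∑-permute)
open FiniteSum ℤP.+-0-commutativeMonoid
  using () renaming (sum to ∑ℤ)
open FiniteSum SignP.*-commutativeMonoid
  using () renaming (sum to ∏; sum-cong-≗ to ∏-cong; ∑-distrib-+ to ∏-*; sum-permute to ∏-permute)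

[_] : Bool → ℕ
[ b ] = if b then 1 else 0

_only-if_ : ℕ → Bool → ℕ
x only-if b = if b then x else 0

foldr-tabulate : ∀ {A : Set} (_∙_ : A → A → A) (ε : A) {m} (f : Fin m → A) →
  foldr _∙_ ε (tabulate f) ≡ Vector.foldr _∙_ ε f
foldr-tabulate _∙_ ε {zero}  f = refl
foldr-tabulate _∙_ ε {suc m} f = cong (f zero ∙_) (foldr-tabulate _∙_ ε (f ∘ suc))

sumℕ-allFin : ∀ {m} (f : Fin m → ℕ) → sumℕ (map f (allFin m)) ≡ ∑ f
sumℕ-allFin {m} f = trans (cong sumℕ (map-tabulate id f)) (foldr-tabulate ℕ._+_ 0 f)

sumℤ-allFin : ∀ {m} (f : Fin m → ℤ) → sumℤ (map f (allFin m)) ≡ ∑ℤ f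
sumℤ-allFin {m} f = trans (cong sumℤ (map-tabulate id f)) (foldr-tabulate ℤ._+_ (+ℤ 0) f)

module _ {A : Set} {p} {P : Pred A p} (P? : Decidable P) where

  sumℕ-filter : ∀ (f : A → ℕ) xs →
    sumℕ (map f (filter P? xs)) ≡ sumℕ (map (λ x → f x only-if does (P? x)) xs)
  sumℕ-filter f [] = refl
  sumℕ-filter f (x ∷ xs) with does (P? x)
  ... | true  = cong (f x ℕ.+_) (sumℕ-filter f xs)
  ... | false = sumℕ-filter f xs

  length-filter : ∀ xs → length (filter P? xs) ≡ sumℕ (map (λ x → [ does (P? x) ]) xs)
  length-filter [] = refl
  length-filter (x ∷ xs) with does (P? x)
  ... | true  = cong suc (length-filter xs)
  ... | false = length-filter xs

∑-ones : ∀ m → ∑ {m} (λ _ → 1) ≡ m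
∑-ones zero    = refl
∑-ones (suc m) = cong suc (∑-ones m)

∑-mono : ∀ {m} {f h : Fin m → ℕ} → (∀ i → f i ≤ h i) → ∑ f ≤ ∑ h
∑-mono {zero}  f≤h = z≤n
∑-mono {suc m} f≤h = ℕP.+-mono-≤ (f≤h zero) (∑-mono (f≤h ∘ suc))

+-≤-equal : ∀ {a b c d} → a ≤ b → c ≤ d → a + c ≡ b + d → a ≡ b × c ≡ d
+-≤-equal {a} {b} {c} {d} a≤b c≤d eq = a≡b , ℕP.+-cancelˡ-≡ a c d (trans eq (cong (_+ d) (sym a≡b)))
  where
  b≤a : b ≤ a
  b≤a = ℕP.+-cancelʳ-≤ d b a (subst (_≤ a + d) eq (ℕP.+-monoʳ-≤ a c≤d))
  a≡b : a ≡ b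
  a≡b = ℕP.≤-antisym a≤b b≤a

∑-≤-equal : ∀ {m} {f h : Fin m → ℕ} → (∀ i → f i ≤ h i) → ∑ f ≡ ∑ h → ∀ i → f i ≡ h i
∑-≤-equal {suc m} f≤h eq zero    = proj₁ (+-≤-equal (f≤h zero) (∑-mono (f≤h ∘ suc)) eq)
∑-≤-equal {suc m} f≤h eq (suc i) =
  ∑-≤-equal (f≤h ∘ suc) (proj₂ (+-≤-equal (f≤h zero) (∑-mono (f≤h ∘ suc)) eq)) i

module SumAway {m : ℕ} (e : Fin m) where

  away : (Fin m → ℕ) → Fin m → ℕ
  away f g = f g only-if not (does (g ≟ e))

  ∑′ : (Fin m → ℕ) → ℕ
  ∑′ f = ∑ (away f)

  ∑-split : ∀ (f : Fin m → ℕ) → ∑ f ≡ f e + ∑′ f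
  ∑-split = split e
    where
    split : ∀ {m} (e : Fin m) (f : Fin m → ℕ) →
      ∑ f ≡ f e + ∑ (λ g → f g only-if not (does (g ≟ e)))
    split zero    f = refl
    split (suc e) f = begin
      f zero + ∑ (f ∘ suc)    ≡⟨ cong (f zero +_) (split e (f ∘ suc)) ⟩
      f zero + (f (suc e) + R) ≡⟨ ℕP.+-comm (f zero) _ ⟩
      (f (suc e) + R) + f zero ≡⟨ ℕP.+-assoc (f (suc e)) R (f zero) ⟩
      f (suc e) + (R + f zero) ≡⟨ cong (f (suc e) +_) (ℕP.+-comm R (f zero)) ⟩
      f (suc e) + (f zero + R) ∎
      where
      open ≡-Reasoning
      R = ∑ (λ g → f (suc g) only-if not (does (g ≟ e)))

  ∑′-cong : ∀ {f h : Fin m → ℕ} → (∀ g → ¬ g ≡ e → f g ≡ h g) → ∑′ f ≡ ∑′ h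
  ∑′-cong {f} {h} f≡h = ∑-cong pointwise
    where
    pointwise : ∀ g → away f g ≡ away h g
    pointwise g with g ≟ e
    ... | yes _   = refl
    ... | no  g≢e = f≡h g g≢e

  ∑′-+ : ∀ (f h : Fin m → ℕ) → ∑′ (λ g → f g + h g) ≡ ∑′ f + ∑′ h
  ∑′-+ f h = trans (∑-cong pointwise) (∑-+ (away f) (away h))
    where
    pointwise : ∀ g → away (λ g → f g + h g) g ≡ away f g + away h g
    pointwise g with does (g ≟ e)
    ... | true  = refl
    ... | false = refl

  away-mono : ∀ {f h : Fin m → ℕ} → (∀ g → f g ≤ h g) → ∀ g → away f g ≤ away h g
  away-mono f≤h g with does (g ≟ e)
  ... | true  = z≤n
  ... | false = f≤h g

  ∑′-mono : ∀ {f h : Fin m → ℕ} → (∀ g → f g ≤ h g) → ∑′ f ≤ ∑′ h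
  ∑′-mono f≤h = ∑-mono (away-mono f≤h)

  ∑′-≤-equal : ∀ {f h : Fin m → ℕ} → (∀ g → f g ≤ h g) → ∑′ f ≡ ∑′ h →
    ∀ g → ¬ g ≡ e → f g ≡ h g
  ∑′-≤-equal {f} {h} f≤h eq g g≢e = unrestricted (∑-≤-equal (away-mono f≤h) eq g)
    where
    unrestricted : away f g ≡ away h g → f g ≡ h g
    unrestricted with g ≟ e
    ... | yes g≡e = ⊥-elim (g≢e g≡e)
    ... | no  _   = id

  ∑′-ones : ∑′ (λ _ → 1) + 1 ≡ m
  ∑′-ones = trans (ℕP.+-comm _ 1) (trans (sym (∑-split (λ _ → 1))) (∑-ones m))

2t+2t≡4t : ∀ t → 2 * t + 2 * t ≡ 4 * t
2t+2t≡4t = ℕSolver.solve-∀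

double-injective : ∀ x y → x + x ≡ y + y → x ≡ y
double-injective x y eq =
  ℕP.*-cancelˡ-≡ x y 2 (trans (cong (x +_) (ℕP.+-identityʳ x)) (trans eq (cong (y +_) (sym (ℕP.+-identityʳ y)))))

isPos isNeg : Sign → ℕ
isPos Sign.+ = 1
isPos Sign.- = 0
isNeg Sign.+ = 0
isNeg Sign.- = 1

isPos+isNeg : ∀ s → isPos s + isNeg s ≡ 1
isPos+isNeg Sign.+ = refl
isPos+isNeg Sign.- = refl

∏-const-even : ∀ j (c : Sign) → ∏ {j + j} (λ _ → c) ≡ Sign.+
∏-const-even j c = go j
  where
  power : ℕ → Sign
  power m = ∏ {m} (λ _ → c)
  two-more : ∀ m → power (suc (suc m)) ≡ power m
  two-more m = begin
    c Sign.* (c Sign.* power m) ≡⟨ SignP.*-assoc c c (power m) ⟨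
    (c Sign.* c) Sign.* power m ≡⟨ cong (Sign._* power m) (SignP.s*s≡+ c) ⟩
    power m                     ∎
    where open ≡-Reasoning
  go : ∀ j → power (j + j) ≡ Sign.+
  go zero    = refl
  go (suc j) = trans (cong (power ∘ suc) (ℕP.+-suc j j)) (trans (two-more (j + j)) (go j))

-- The shift by 2 modulo 4 that a negative product induces on a ±1-sum.
shift : Sign → ℤ
shift Sign.+ = +ℤ 0
shift Sign.- = +ℤ 2

-- The carry (a multiple of 4) when a term s is prepended to a sum with product p.
carry : Sign → Sign → ℤ
carry Sign.- Sign.- = - (+ℤ 1)
carry _      _      = +ℤ 0

carry-spec : ∀ s p → (sgn s ℤ.+ shift (s Sign.* p)) ℤ.- shift p ≡ +ℤ 1 ℤ.+ +ℤ 4 ℤ.* carry s p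
carry-spec Sign.+ Sign.+ = refl
carry-spec Sign.+ Sign.- = refl
carry-spec Sign.- Sign.+ = refl
carry-spec Sign.- Sign.- = refl

±1-sum-mod4 : ∀ m (f : Fin m → Sign) →
  ∃ λ k → ∑ℤ (sgn ∘ f) ℤ.+ shift (∏ f) ≡ +ℤ m ℤ.+ +ℤ 4 ℤ.* k
±1-sum-mod4 zero    f = +ℤ 0 , refl
±1-sum-mod4 (suc m) f with ±1-sum-mod4 m (f ∘ suc)
... | k , eq = k ℤ.+ carry s p , (begin
  (sgn s ℤ.+ S) ℤ.+ shift (s Sign.* p)                      ≡⟨ regroup (sgn s) (shift (s Sign.* p)) (shift p) S ⟩
  ((sgn s ℤ.+ shift (s Sign.* p)) ℤ.- shift p) ℤ.+ (S ℤ.+ shift p) ≡⟨ cong₂ ℤ._+_ (carry-spec s p) eq ⟩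
  (+ℤ 1 ℤ.+ +ℤ 4 ℤ.* carry s p) ℤ.+ (+ℤ m ℤ.+ +ℤ 4 ℤ.* k)   ≡⟨ regroup′ (carry s p) (+ℤ m) k ⟩
  (+ℤ 1 ℤ.+ +ℤ m) ℤ.+ +ℤ 4 ℤ.* (k ℤ.+ carry s p)            ∎)
  where
  open ≡-Reasoning
  s = f zero
  p = ∏ (f ∘ suc)
  S = ∑ℤ (sgn ∘ f ∘ suc)
  regroup : ∀ a b c x → (a ℤ.+ x) ℤ.+ b ≡ ((a ℤ.+ b) ℤ.- c) ℤ.+ (x ℤ.+ c)
  regroup = solve-∀
  regroup′ : ∀ d x k → (+ℤ 1 ℤ.+ +ℤ 4 ℤ.* d) ℤ.+ (x ℤ.+ +ℤ 4 ℤ.* k) ≡ (+ℤ 1 ℤ.+ x) ℤ.+ +ℤ 4 ℤ.* (k ℤ.+ d)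
  regroup′ = solve-∀

pos-4a+2 : ∀ a → +ℤ (4 * a + 2) ≡ +ℤ 4 ℤ.* +ℤ a ℤ.+ +ℤ 2
pos-4a+2 a = trans (ℤP.pos-+ (4 * a) 2) (cong (ℤ._+ +ℤ 2) (ℤP.pos-* 4 a))

2≤∣4j+2∣ : ∀ j → 2 ≤ ∣ +ℤ 4 ℤ.* j ℤ.+ +ℤ 2 ∣
2≤∣4j+2∣ (+ℤ a)    = subst (2 ≤_) (cong ∣_∣ (pos-4a+2 a)) (ℕP.m≤n+m 2 (4 * a))
2≤∣4j+2∣ -[1+ a ] = subst (2 ≤_) mirror (2≤∣4j+2∣ (+ℤ a))
  where
  negate : ∀ x → +ℤ 4 ℤ.* - (+ℤ 1 ℤ.+ x) ℤ.+ +ℤ 2 ≡ - (+ℤ 4 ℤ.* x ℤ.+ +ℤ 2)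
  negate = solve-∀
  mirror : ∣ +ℤ 4 ℤ.* +ℤ a ℤ.+ +ℤ 2 ∣ ≡ ∣ +ℤ 4 ℤ.* -[1+ a ] ℤ.+ +ℤ 2 ∣
  mirror = trans (sym (ℤP.∣-i∣≡∣i∣ (+ℤ 4 ℤ.* +ℤ a ℤ.+ +ℤ 2))) (cong ∣_∣ (sym (negate (+ℤ a))))

positive-row : ∀ t (f : Fin (4 * t + 2) → Sign) → ∏ f ≡ Sign.+ → 2 ≤ ∣ ∑ℤ (sgn ∘ f) ∣
positive-row t f ∏f≡+ with ±1-sum-mod4 (4 * t + 2) f
... | k , eq = subst (λ r → 2 ≤ ∣ r ∣) (sym sum≡) (2≤∣4j+2∣ (+ℤ t ℤ.+ k))
  where
  open ≡-Reasoning
  regroup : ∀ x k → (+ℤ 4 ℤ.* x ℤ.+ +ℤ 2) ℤ.+ +ℤ 4 ℤ.* k ≡ +ℤ 4 ℤ.* (x ℤ.+ k) ℤ.+ +ℤ 2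
  regroup = solve-∀
  sum≡ : ∑ℤ (sgn ∘ f) ≡ +ℤ 4 ℤ.* (+ℤ t ℤ.+ k) ℤ.+ +ℤ 2
  sum≡ = begin
    ∑ℤ (sgn ∘ f)                                ≡⟨ ℤP.+-identityʳ _ ⟨
    ∑ℤ (sgn ∘ f) ℤ.+ shift Sign.+               ≡⟨ cong (λ p → ∑ℤ (sgn ∘ f) ℤ.+ shift p) ∏f≡+ ⟨
    ∑ℤ (sgn ∘ f) ℤ.+ shift (∏ f)                ≡⟨ eq ⟩
    +ℤ (4 * t + 2) ℤ.+ +ℤ 4 ℤ.* k               ≡⟨ cong (ℤ._+ +ℤ 4 ℤ.* k) (pos-4a+2 t) ⟩
    (+ℤ 4 ℤ.* +ℤ t ℤ.+ +ℤ 2) ℤ.+ +ℤ 4 ℤ.* k     ≡⟨ regroup (+ℤ t) k ⟩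
    +ℤ 4 ℤ.* (+ℤ t ℤ.+ k) ℤ.+ +ℤ 2             ∎

module SignCharacter {m : ℕ} (_·_ : Fin m → Fin m → Fin m) (e : Fin m) (inv : Fin m → Fin m)
                     (isGroup : IsGroup _≡_ _·_ e inv) where

  open IsGroup isGroup using (assoc; identityˡ; inverseˡ; inverseʳ)

  IsCharacter : (Fin m → Sign) → Set
  IsCharacter Φ = ∀ g h → Φ (g · h) ≡ Φ g Sign.* Φ h

  translation : Fin m → Permutation′ m
  translation h = permutation (h ·_) (inv h ·_) cancel-inv cancel
    where
    cancel-inv : ∀ y → h · (inv h · y) ≡ y
    cancel-inv y = trans (sym (assoc h (inv h) y)) (trans (cong (_· y) (inverseʳ h)) (identityˡ y))
    cancel : ∀ y → inv h · (h · y) ≡ y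
    cancel y = trans (sym (assoc (inv h) h y)) (trans (cong (_· y) (inverseˡ h)) (identityˡ y))

  character-identity : ∀ {Φ} → IsCharacter Φ → Φ e ≡ Sign.+
  character-identity {Φ} hom =
    trans (cong Φ (sym (identityˡ e))) (trans (hom e e) (SignP.s*s≡+ (Φ e)))

  -- Translating by an element with Φ(a) = -1 swaps the signs of Φ, so a
  -- nontrivial character is -1 and +1 equally often.
  balanced : ∀ {Φ} → IsCharacter Φ → ∀ a → Φ a ≡ Sign.- → ∑ (isNeg ∘ Φ) ≡ ∑ (isPos ∘ Φ)
  balanced {Φ} hom a Φa≡- = begin
    ∑ (isNeg ∘ Φ)               ≡⟨ ∑-permute (isNeg ∘ Φ) (translation a) ⟩
    ∑ (λ g → isNeg (Φ (a · g))) ≡⟨ ∑-cong swapped ⟩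
    ∑ (isPos ∘ Φ)               ∎
    where
    open ≡-Reasoning
    flip : ∀ s → isNeg (Sign.- Sign.* s) ≡ isPos s
    flip Sign.+ = refl
    flip Sign.- = refl
    swapped : ∀ g → isNeg (Φ (a · g)) ≡ isPos (Φ g)
    swapped g = trans (cong isNeg (trans (hom a g) (cong (Sign._* Φ g) Φa≡-))) (flip (Φ g))

  -- For a 2-cocycle on a group of even order, the row products form a
  -- character: multiply the cocycle identity over k and reindex k ↦ hk.
  cocycle-character : ∀ j → m ≡ j + j → ∀ ψ → IsCocycle _·_ e ψ → IsCharacter (λ g → ∏ (ψ g))
  cocycle-character j m≡j+j ψ cocycle g h = begin
    ∏ (ψ (g · h))                                       ≡⟨ SignP.*-identityˡ _ ⟨
    Sign.+ Sign.* ∏ (ψ (g · h))                         ≡⟨ cong (Sign._* ∏ (ψ (g · h))) (sym even-power) ⟩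
    ∏ {m} (λ _ → ψ g h) Sign.* ∏ (ψ (g · h))            ≡⟨ ∏-* (λ _ → ψ g h) (ψ (g · h)) ⟨
    ∏ (λ k → ψ g h Sign.* ψ (g · h) k)                  ≡⟨ ∏-cong (IsCocycle.cocycle cocycle g h) ⟩
    ∏ (λ k → ψ g (h · k) Sign.* ψ h k)                  ≡⟨ ∏-* (λ k → ψ g (h · k)) (ψ h) ⟩
    ∏ (λ k → ψ g (h · k)) Sign.* ∏ (ψ h)                ≡⟨ cong (Sign._* ∏ (ψ h)) (∏-permute (ψ g) (translation h)) ⟨
    ∏ (ψ g) Sign.* ∏ (ψ h)                              ∎
    where
    open ≡-Reasoning
    even-power : ∏ {m} (λ _ → ψ g h) ≡ Sign.+
    even-power = subst (λ n → ∏ {n} (λ _ → ψ g h) ≡ Sign.+) (sym m≡j+j) (∏-const-even j (ψ g h))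

is±2 : ∀ r → does (r ℤP.≟ +ℤ 2) ∨ does (r ℤP.≟ - (+ℤ 2)) ≡ (∣ r ∣ ≡ᵇ 2)
is±2 (+ℤ n)    = ∨-identityʳ _
is±2 -[1+ n ] = refl

is0 : ∀ r → does (r ℤP.≟ +ℤ 0) ≡ (∣ r ∣ ≡ᵇ 0)
is0 (+ℤ n)    = refl
is0 -[1+ n ] = refl

[∧]-only-if : ∀ b c → [ b ∧ c ] ≡ [ c ] only-if b
[∧]-only-if true  c = refl
[∧]-only-if false c = refl

exclusive : ∀ a → [ a ≡ᵇ 2 ] + [ a ≡ᵇ 0 ] ≤ 1
exclusive 0                   = ℕP.≤-refl
exclusive 1                   = z≤n
exclusive 2                   = ℕP.≤-refl
exclusive (suc (suc (suc a))) = z≤n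

classified : ∀ a → [ a ≡ᵇ 2 ] + [ a ≡ᵇ 0 ] ≡ 1 → a ≡ [ a ≡ᵇ 2 ] + [ a ≡ᵇ 2 ]
classified 0 _ = refl
classified 2 _ = refl

module QuasiOrthogonal (t : ℕ) (_·_ : Fin (4 * t + 2) → Fin (4 * t + 2) → Fin (4 * t + 2))
    (e : Fin (4 * t + 2)) (inv : Fin (4 * t + 2) → Fin (4 * t + 2))
    (isGroup : IsGroup _≡_ _·_ e inv)
    (ψ : Fin (4 * t + 2) → Fin (4 * t + 2) → Sign) (cocycle : IsCocycle _·_ e ψ) where

  open SumAway e
  open SignCharacter _·_ e inv isGroup

  Φ : Fin (4 * t + 2) → Sign
  Φ g = ∏ (ψ g)

  ∣r∣ : Fin (4 * t + 2) → ℕ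
  ∣r∣ g = ∣ rowSum ψ g ∣

  Φ-character : IsCharacter Φ
  Φ-character = cocycle-character (2 * t + 1) (halves t) ψ cocycle
    where
    halves : ∀ t → 4 * t + 2 ≡ (2 * t + 1) + (2 * t + 1)
    halves = ℕSolver.solve-∀

  RE-as-sum : RE e ψ ≡ ∑′ ∣r∣
  RE-as-sum = trans (sumℕ-filter (λ g → ¬? (g ≟ e)) ∣r∣ (allFin _)) (sumℕ-allFin (away ∣r∣))

  count-as-sum : ∀ {p} {P : Pred (Fin (4 * t + 2)) p} (P? : Decidable P) (test : ℕ → Bool) →
    (∀ g → does (P? g) ≡ not (does (g ≟ e)) ∧ test (∣r∣ g)) →
    length (filter P? (allFin _)) ≡ ∑′ (λ g → [ test (∣r∣ g) ])
  count-as-sum P? test P?≡ = trans (length-filter P? (allFin _)) (trans (sumℕ-allFin (λ g → [ does (P? g) ]))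
    (∑-cong λ g → trans (cong [_] (P?≡ g)) ([∧]-only-if (not (does (g ≟ e))) (test (∣r∣ g)))))

  X₁-as-sum : cardX₁ e ψ ≡ ∑′ (λ g → [ ∣r∣ g ≡ᵇ 2 ])
  X₁-as-sum = count-as-sum _ (_≡ᵇ 2) (λ g → cong (not (does (g ≟ e)) ∧_) (is±2 (rowSum ψ g)))

  X₂-as-sum : cardX₂ e ψ ≡ ∑′ (λ g → [ ∣r∣ g ≡ᵇ 0 ])
  X₂-as-sum = count-as-sum _ (_≡ᵇ 0) (λ g → cong (not (does (g ≟ e)) ∧_) (is0 (rowSum ψ g)))

  nonidentity-count : ∑′ (λ _ → 1) ≡ 4 * t + 1
  nonidentity-count = ℕP.+-cancelʳ-≡ 1 _ _ (trans ∑′-ones (sym (ℕP.+-assoc (4 * t) 1 1)))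

  -- (⇐) X₁ and X₂ are disjoint and fill G ∖ {e}, so RE = 2|X₁|.
  sizes⇒quasi : cardX₁ e ψ ≡ 2 * t × cardX₂ e ψ ≡ 2 * t + 1 → RE e ψ ≡ 4 * t
  sizes⇒quasi (|X₁| , |X₂|) = begin
    RE e ψ                     ≡⟨ RE-as-sum ⟩
    ∑′ ∣r∣                     ≡⟨ ∑′-cong (λ g g≢e → classified (∣r∣ g) (in-X₁-or-X₂ g g≢e)) ⟩
    ∑′ (λ g → inX₁ g + inX₁ g) ≡⟨ ∑′-+ inX₁ inX₁ ⟩
    ∑′ inX₁ + ∑′ inX₁          ≡⟨ cong₂ _+_ X₁≡ X₁≡ ⟩
    2 * t + 2 * t              ≡⟨ 2t+2t≡4t t ⟩
    4 * t                      ∎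
    where
    open ≡-Reasoning
    inX₁ inX₂ : Fin (4 * t + 2) → ℕ
    inX₁ g = [ ∣r∣ g ≡ᵇ 2 ]
    inX₂ g = [ ∣r∣ g ≡ᵇ 0 ]
    X₁≡ : ∑′ inX₁ ≡ 2 * t
    X₁≡ = trans (sym X₁-as-sum) |X₁|
    X₂≡ : ∑′ inX₂ ≡ 2 * t + 1
    X₂≡ = trans (sym X₂-as-sum) |X₂|
    split : ∀ t → 2 * t + (2 * t + 1) ≡ 4 * t + 1
    split = ℕSolver.solve-∀
    in-X₁-or-X₂ : ∀ g → ¬ g ≡ e → inX₁ g + inX₂ g ≡ 1
    in-X₁-or-X₂ = ∑′-≤-equal (λ g → exclusive (∣r∣ g)) (begin
      ∑′ (λ g → inX₁ g + inX₂ g) ≡⟨ ∑′-+ inX₁ inX₂ ⟩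
      ∑′ inX₁ + ∑′ inX₂          ≡⟨ cong₂ _+_ X₁≡ X₂≡ ⟩
      2 * t + (2 * t + 1)        ≡⟨ split t ⟩
      4 * t + 1                  ≡⟨ nonidentity-count ⟨
      ∑′ (λ _ → 1)               ∎)

  -- A row with Φ(g) = +1 has |r_g| ≥ 2 (|r_g| ≡ 2 mod 4).
  row-floor : ∀ g → isPos (Φ g) + isPos (Φ g) ≤ ∣r∣ g
  row-floor g with Φ g in Φg≡
  ... | Sign.+ = subst (2 ≤_) (cong ∣_∣ (sym (sumℤ-allFin (sgn ∘ ψ g)))) (positive-row t (ψ g) Φg≡)
  ... | Sign.- = z≤n

  RE-lower : ∑′ (isPos ∘ Φ) + ∑′ (isPos ∘ Φ) ≤ RE e ψ
  RE-lower = subst₂ _≤_ (∑′-+ (isPos ∘ Φ) (isPos ∘ Φ)) (sym RE-as-sum) (∑′-mono row-floor)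

  sign-counts : ∀ a → Φ a ≡ Sign.- → ∑′ (isPos ∘ Φ) ≡ 2 * t × ∑′ (isNeg ∘ Φ) ≡ 2 * t + 1
  sign-counts a Φa≡- = pos≡ , trans neg≡1+pos (trans (cong suc pos≡) (ℕP.+-comm 1 (2 * t)))
    where
    open ≡-Reasoning
    pos neg : ℕ
    pos = ∑′ (isPos ∘ Φ)
    neg = ∑′ (isNeg ∘ Φ)
    Φe≡+ : Φ e ≡ Sign.+
    Φe≡+ = character-identity Φ-character
    neg≡1+pos : neg ≡ 1 + pos
    neg≡1+pos = begin
      neg                  ≡⟨⟩
      isNeg Sign.+ + neg   ≡⟨ cong (λ s → isNeg s + neg) Φe≡+ ⟨
      isNeg (Φ e) + neg    ≡⟨ ∑-split (isNeg ∘ Φ) ⟨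
      ∑ (isNeg ∘ Φ)        ≡⟨ balanced Φ-character a Φa≡- ⟩
      ∑ (isPos ∘ Φ)        ≡⟨ ∑-split (isPos ∘ Φ) ⟩
      isPos (Φ e) + pos    ≡⟨ cong (λ s → isPos s + pos) Φe≡+ ⟩
      1 + pos              ∎
    pos+neg : pos + neg ≡ 4 * t + 1
    pos+neg = trans (sym (∑′-+ (isPos ∘ Φ) (isNeg ∘ Φ)))
                    (trans (∑′-cong (λ g _ → isPos+isNeg (Φ g))) nonidentity-count)
    rearrange : ∀ p t → p + (1 + p) ≡ 4 * t + 1 → p + p ≡ 2 * t + 2 * t
    rearrange p t eq = ℕP.+-cancelʳ-≡ 1 _ _ (trans (identity₁ p) (trans eq (cong (_+ 1) (sym (2t+2t≡4t t)))))
      where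
      identity₁ : ∀ p → (p + p) + 1 ≡ p + (1 + p)
      identity₁ = ℕSolver.solve-∀
    pos≡ : pos ≡ 2 * t
    pos≡ = double-injective pos (2 * t) (rearrange pos t (trans (cong (pos +_) (sym neg≡1+pos)) pos+neg))

  -- If RE = 4t then Φ is nontrivial: otherwise RE ≥ 2(4t+1).
  quasi⇒nontrivial : RE e ψ ≡ 4 * t → ∃ λ a → Φ a ≡ Sign.-
  quasi⇒nontrivial RE≡4t with any? (λ a → Φ a SignP.≟ Sign.-)
  ... | yes nontrivial = nontrivial
  ... | no  trivial    = ⊥-elim (ℕP.<-irrefl refl (subst (_≤ 4 * t) (ℕP.+-comm (4 * t) 1) too-large))
    where
    positive : ∀ g → Φ g ≡ Sign.+
    positive g with Φ g in Φg≡
    ... | Sign.+ = refl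
    ... | Sign.- = ⊥-elim (trivial (g , Φg≡))
    all-positive : ∑′ (isPos ∘ Φ) ≡ 4 * t + 1
    all-positive = trans (∑′-cong (λ g _ → cong isPos (positive g))) nonidentity-count
    too-large : 4 * t + 1 ≤ 4 * t
    too-large = ℕP.≤-trans (ℕP.m≤m+n _ _)
                  (subst₂ _≤_ (cong₂ _+_ all-positive all-positive) RE≡4t RE-lower)

  -- If RE = 4t, the bound RE-lower is attained, so every nonidentity row
  -- sits at its floor: |r_g| = 2 on the kernel of Φ and 0 off it.
  quasi⇒floor : RE e ψ ≡ 4 * t → ∀ a → Φ a ≡ Sign.- →
    ∀ g → ¬ g ≡ e → isPos (Φ g) + isPos (Φ g) ≡ ∣r∣ g
  quasi⇒floor RE≡4t a Φa≡- = ∑′-≤-equal row-floor (begin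
    ∑′ (λ g → isPos (Φ g) + isPos (Φ g)) ≡⟨ ∑′-+ (isPos ∘ Φ) (isPos ∘ Φ) ⟩
    ∑′ (isPos ∘ Φ) + ∑′ (isPos ∘ Φ)     ≡⟨ cong₂ _+_ kernel kernel ⟩
    2 * t + 2 * t                       ≡⟨ 2t+2t≡4t t ⟩
    4 * t                               ≡⟨ RE≡4t ⟨
    RE e ψ                              ≡⟨ RE-as-sum ⟩
    ∑′ ∣r∣                              ∎)
    where
    open ≡-Reasoning
    kernel : ∑′ (isPos ∘ Φ) ≡ 2 * t
    kernel = proj₁ (sign-counts a Φa≡-)

  -- (⇒) At the floor, X₁ is the kernel of Φ minus e and X₂ its complement.
  quasi⇒sizes : RE e ψ ≡ 4 * t → cardX₁ e ψ ≡ 2 * t × cardX₂ e ψ ≡ 2 * t + 1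
  quasi⇒sizes RE≡4t with quasi⇒nontrivial RE≡4t
  ... | a , Φa≡- = counted (_≡ᵇ 2) isPos X₁-as-sum at-floor-2 (proj₁ (sign-counts a Φa≡-)) ,
                   counted (_≡ᵇ 0) isNeg X₂-as-sum at-floor-0 (proj₂ (sign-counts a Φa≡-))
    where
    at-floor-2 : ∀ s → [ (isPos s + isPos s) ≡ᵇ 2 ] ≡ isPos s
    at-floor-2 Sign.+ = refl
    at-floor-2 Sign.- = refl
    at-floor-0 : ∀ s → [ (isPos s + isPos s) ≡ᵇ 0 ] ≡ isNeg s
    at-floor-0 Sign.+ = refl
    at-floor-0 Sign.- = refl
    counted : ∀ (test : ℕ → Bool) (ind : Sign → ℕ) {card c} → card ≡ ∑′ (λ g → [ test (∣r∣ g) ]) →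
      (∀ s → [ test (isPos s + isPos s) ] ≡ ind s) → ∑′ (ind ∘ Φ) ≡ c → card ≡ c
    counted test ind card≡ floor-test ind≡c = trans card≡ (trans (∑′-cong λ g g≢e →
      trans (cong (λ x → [ test x ]) (sym (quasi⇒floor RE≡4t a Φa≡- g g≢e))) (floor-test (Φ g))) ind≡c)

-- Lemma 2: for a group of order 4t+2, a normalized 2-cocycle ψ is
-- quasi-orthogonal iff |X₁| = 2t and |X₂| = 2t+1 (the argument does not
-- need the hypothesis 1 ≤ t).
lemma2 : (t : ℕ) → 1 ≤ t →
    (_·_ : Fin (4 * t + 2) → Fin (4 * t + 2) → Fin (4 * t + 2))
    (e : Fin (4 * t + 2)) (inv : Fin (4 * t + 2) → Fin (4 * t + 2)) →
    IsGroup _≡_ _·_ e inv →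
    (ψ : Fin (4 * t + 2) → Fin (4 * t + 2) → Sign) → IsCocycle _·_ e ψ →
    (RE e ψ ≡ 4 * t) ⇔ (cardX₁ e ψ ≡ 2 * t × cardX₂ e ψ ≡ 2 * t + 1)
lemma2 t _ _·_ e inv isGroup ψ cocycle = mk⇔ quasi⇒sizes sizes⇒quasi
  where open QuasiOrthogonal t _·_ e inv isGroup ψ cocycle
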